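{- Let $\mathcal{Q}$ be a generalised quadrangle of order $(s,s^2)$ with $s>1$ odd, with point set $\mathcal{P}$ and collinearity adjacency matrix $A$. Let $x,y$ be two noncollinear points and let $\mathcal{T}$ be the multiset of points consisting of $\{x,y\}^\perp$ together with $s$ copies of $x$ and $s$ copies of $y$, i.e. $\mathcal{T}=\chi_{\{x,y\}^\perp}+s(\chi_{\{x\}}+\chi_{\{y\}})$. Then $\mathcal{T}$ is a weighted tight set, i.e. $\mathcal{T}\in V^0\oplus V^+$.
   Context: $\{x,y\}^\perp$ is the set of points collinear with both $x$ and $y$. The space $\mathbb{C}\mathcal{P}$ of functions $\mathcal{P}\to\mathbb{C}$ decomposes orthogonally into eigenspaces $V^0,V^+,V^-$ of $A$ with eigenvalues $s(s^2+1)$, $s-1$ and $-s^2-1$ respectively; $V^0$ is spanned by the all-one function. A weighted tight set is a function $\mathcal{P}\to\mathbb{N}_0$ lying in $V^0\oplus V^+$. -}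

module Defs where

open import Data.Nat as ℕ using (ℕ; suc; zero)
open import Data.Fin using (Fin; zero; suc)
open import Data.Fin.Properties using (_≟_)
open import Data.Bool using (Bool; true; false; _∧_; not; if_then_else_)
open import Relation.Nullary.Decidable using (⌊_⌋)
open import Relation.Binary.PropositionalEquality using (_≡_; _≢_)
open import Data.Product using (Σ; _×_; ∃-syntax)
open import Data.Integer using (+_)
open import Data.Rational using (ℚ; _/_; _+_; _*_; 0ℚ)

count : ∀ {n} → (Fin n → Bool) → ℕ
count {zero} P = 0
count {suc n} P = (if P zero then 1 else 0) ℕ.+ count (λ i → P (suc i))

anyFin : ∀ {n} → (Fin n → Bool) → Bool
anyFin {zero} P = false
anyFin {suc n} P = Data.Bool._∨_ (P zero) (anyFin (λ i → P (suc i)))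
  where import Data.Bool

sumFin : ∀ {n} → (Fin n → ℚ) → ℚ
sumFin {zero} f = 0ℚ
sumFin {suc n} f = f zero + sumFin (λ i → f (suc i))

ℕtoℚ : ℕ → ℚ
ℕtoℚ n = + n / 1

record IncStr : Set where
  field
    np nl : ℕ
    I : Fin np → Fin nl → Bool

module _ (S : IncStr) where
  open IncStr S

  Point : Set
  Point = Fin np

  collinear : Point → Point → Bool
  collinear x y = not ⌊ x ≟ y ⌋ ∧ anyFin (λ l → I x l ∧ I y l)

  A : Point → Point → ℚ
  A x y = if collinear x y then ℚ1 else 0ℚ
    where ℚ1 = + 1 / 1

  applyA : (Point → ℚ) → (Point → ℚ)
  applyA f x = sumFin (λ y → A x y * f y)

  InEigenspace : ℚ → (Point → ℚ) → Set
  InEigenspace λ₀ f = ∀ x → applyA f x ≡ λ₀ * f x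

  record IsGQ (s t : ℕ) : Set where
    field
      line-size   : ∀ l → count (λ p → I p l) ≡ suc s
      point-deg   : ∀ p → count (λ l → I p l) ≡ suc t
      one-line    : ∀ p q l m → p ≢ q → I p l ≡ true → I q l ≡ true →
                    I p m ≡ true → I q m ≡ true → l ≡ m
      gq-axiom    : ∀ p l → I p l ≡ false →
                    count (λ q → I q l ∧ collinear p q) ≡ 1

  InV0⊕V+ : (s : ℕ) → (Point → ℚ) → Set
  InV0⊕V+ s f = ∃[ g ] ∃[ h ]
      InEigenspace (ℕtoℚ (s ℕ.* (s ℕ.* s ℕ.+ 1))) g
    × InEigenspace (ℕtoℚ s Data.Rational.- ℕtoℚ 1) h
    × (∀ x → f x ≡ g x + h x)
    where import Data.Rational

  WeightedTight : (s : ℕ) → (Point → ℕ) → Set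
  WeightedTight s T = InV0⊕V+ s (λ x → ℕtoℚ (T x))

  δ : Point → Point → ℕ
  δ x z = if ⌊ z ≟ x ⌋ then 1 else 0

  Tmult : ℕ → Point → Point → Point → ℕ
  Tmult s x y z = (if collinear z x ∧ collinear z y then 1 else 0)
                  ℕ.+ s ℕ.* (δ x z ℕ.+ δ y z)

-- Counting in the quadrangle gives A T + T = s T + (s + 1)
-- pointwise. The only non-immediate case is a point z outside x^⊥ ∪ y^⊥, which must be collinear
-- with exactly s + 1 points of {x,y}^⊥: double counting gives the sum and the sum of squares of
-- these numbers over all such z, and for order (s, s²) their variance is zero. Since every row of A
-- sums to s (s² + 1), the constant c = (s + 1)/(s³ + 1) lies in V⁰ and T − c lies in V⁺.

module Submission where

open import Defs
open import Data.Nat as ℕ using (ℕ; zero; suc)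
open import Data.Nat.Properties using (+-*-semiring)
open import Data.Fin using (Fin; zero; suc)
open import Data.Fin.Properties using (_≟_) renaming (suc-injective to Fin-suc-injective)
open import Data.Bool using (Bool; true; false; _∧_; _∨_; not; if_then_else_)
open import Data.Bool.Properties using (∨-zeroʳ; ∧-assoc; ∧-comm; not-injective)
open import Data.Empty using (⊥; ⊥-elim)
open import Data.Product using (_×_; _,_; proj₁; proj₂; ∃-syntax)
open import Data.Sum using (_⊎_; inj₁; inj₂)
open import Function using (_∘_)
open import Relation.Nullary using (Dec; yes; no)
open import Relation.Nullary.Decidable using (⌊_⌋)
open import Relation.Binary.PropositionalEquality
open import Algebra.Properties.Semiring.Sum +-*-semiring using (sum)

⟦_⟧ : Bool → ℕ
⟦ b ⟧ = if b then 1 else 0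

#_ : ∀ {n} → (Fin n → Bool) → ℕ
# P = sum (λ i → ⟦ P i ⟧)

-- Eigenvectors over ℚ

module Eigenvectors where

  import Data.Integer as ℤ
  open import Data.Nat.Coprimality using (1-coprimeTo) renaming (sym to coprime-sym)
  open import Data.Rational using (ℚ; mkℚ; _+_; _*_; _-_; 1ℚ; 1/_)
  open import Data.Rational.Properties
    using (+-*-commutativeRing; ↥p/↧p≡p; toℚᵘ-injective; toℚᵘ-homo-+; *-inverseˡ; *-assoc; *-identityʳ)
  import Data.Rational.Unnormalised as ℚᵘ
  import Data.Rational.Unnormalised.Properties as ℚᵘ
  open import Data.Rational.Solver using (module +-*-Solver)
  open import Algebra.Bundles using (CommutativeRing)
  open import Algebra.Properties.Semiring.Sum (CommutativeRing.semiring +-*-commutativeRing)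
    using () renaming (sum to sumℚ; sum-cong-≗ to sum-congℚ; ∑-distrib-+ to ∑ℚ-distrib-+; *-distribʳ-sum to *-distribʳ-sumℚ)
  open import Algebra.Properties.Semiring.Mult (CommutativeRing.semiring +-*-commutativeRing)
    using (×-homo-+; ×1-homo-*) renaming (_×_ to _×′_)
  import Data.Integer.Tactic.RingSolver as ℤ-Solver

  -- ℕtoℚ n with its numerator visible, so that NonZero (ι (suc n)) is found by instance search
  ι : ℕ → ℚ
  ι n = mkℚ (ℤ.+ n) 0 (coprime-sym (1-coprimeTo n))

  ℕtoℚ≡ι : ∀ n → ℕtoℚ n ≡ ι n
  ℕtoℚ≡ι n = ↥p/↧p≡p (ι n)

  ι-suc : ∀ n → ι (suc n) ≡ 1ℚ + ι n
  ι-suc n = toℚᵘ-injective (ℚᵘ.≃-sym (ℚᵘ.≃-trans (toℚᵘ-homo-+ 1ℚ (ι n)) (ℚᵘ.*≡* (cross-multiplied (ℤ.+ n)))))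
    where
    cross-multiplied : ∀ m → (ℤ.1ℤ ℤ.* ℤ.1ℤ ℤ.+ m ℤ.* ℤ.1ℤ) ℤ.* ℤ.1ℤ ≡ (ℤ.1ℤ ℤ.+ m) ℤ.* (ℤ.1ℤ ℤ.* ℤ.1ℤ)
    cross-multiplied = ℤ-Solver.solve-∀

  ℕtoℚ≡×1 : ∀ n → ℕtoℚ n ≡ n ×′ 1ℚ
  ℕtoℚ≡×1 zero    = refl
  ℕtoℚ≡×1 (suc n) = trans (ℕtoℚ≡ι (suc n)) (trans (ι-suc n) (cong (1ℚ +_) (trans (sym (ℕtoℚ≡ι n)) (ℕtoℚ≡×1 n))))

  ℕtoℚ-+ : ∀ m n → ℕtoℚ (m ℕ.+ n) ≡ ℕtoℚ m + ℕtoℚ n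
  ℕtoℚ-+ m n rewrite ℕtoℚ≡×1 (m ℕ.+ n) | ℕtoℚ≡×1 m | ℕtoℚ≡×1 n = ×-homo-+ 1ℚ m n

  ℕtoℚ-* : ∀ m n → ℕtoℚ (m ℕ.* n) ≡ ℕtoℚ m * ℕtoℚ n
  ℕtoℚ-* m n rewrite ℕtoℚ≡×1 (m ℕ.* n) | ℕtoℚ≡×1 m | ℕtoℚ≡×1 n = ×1-homo-* m n

  sumFin≡sumℚ : ∀ {n} (f : Fin n → ℚ) → sumFin f ≡ sumℚ f
  sumFin≡sumℚ {zero}  f = refl
  sumFin≡sumℚ {suc n} f = cong (f zero +_) (sumFin≡sumℚ (f ∘ suc))

  sumFin-ℕtoℚ : ∀ {n} (f : Fin n → ℕ) → sumFin (ℕtoℚ ∘ f) ≡ ℕtoℚ (sum f)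
  sumFin-ℕtoℚ {zero}  f = refl
  sumFin-ℕtoℚ {suc n} f = trans (cong (ℕtoℚ (f zero) +_) (sumFin-ℕtoℚ (f ∘ suc))) (sym (ℕtoℚ-+ (f zero) _))

  ℕtoℚ-suc : ∀ n → ℕtoℚ (suc n) ≡ 1ℚ + ℕtoℚ n
  ℕtoℚ-suc = ℕtoℚ-+ 1

  sumFin-cong : ∀ {n} {f g : Fin n → ℚ} → (∀ i → f i ≡ g i) → sumFin f ≡ sumFin g
  sumFin-cong {zero}  f≡g = refl
  sumFin-cong {suc n} f≡g = cong₂ _+_ (f≡g zero) (sumFin-cong (f≡g ∘ suc))

  sumFin-shift : ∀ {n} (a u : Fin n → ℚ) c → sumFin (λ i → a i * (u i - c)) + sumFin a * c ≡ sumFin (λ i → a i * u i)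
  sumFin-shift a u c = begin
    sumFin (λ i → a i * (u i - c)) + sumFin a * c
      ≡⟨ cong₂ _+_ (sumFin≡sumℚ (λ i → a i * (u i - c))) (cong (_* c) (sumFin≡sumℚ a)) ⟩
    sumℚ (λ i → a i * (u i - c)) + sumℚ a * c            ≡⟨ cong (sumℚ (λ i → a i * (u i - c)) +_) (*-distribʳ-sumℚ c a) ⟩
    sumℚ (λ i → a i * (u i - c)) + sumℚ (λ i → a i * c)  ≡⟨ sym (∑ℚ-distrib-+ (λ i → a i * (u i - c)) (λ i → a i * c)) ⟩
    sumℚ (λ i → a i * (u i - c) + a i * c)               ≡⟨ sum-congℚ (λ i → cancel (a i) (u i) c) ⟩
    sumℚ (λ i → a i * u i)                               ≡⟨ sym (sumFin≡sumℚ (λ i → a i * u i)) ⟩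
    sumFin (λ i → a i * u i)                             ∎
    where
    open ≡-Reasoning
    open +-*-Solver
    cancel : ∀ a u c → a * (u - c) + a * c ≡ a * u
    cancel = solve 3 (λ a u c → a :* (u :- c) :+ a :* c := a :* u) refl

  A≡ℕtoℚ : ∀ S x y → A S x y ≡ ℕtoℚ ⟦ collinear S x y ⟧
  A≡ℕtoℚ S x y with collinear S x y
  ... | true  = refl
  ... | false = refl

  applyA-ℕtoℚ : ∀ S (f : Point S → ℕ) x → applyA S (ℕtoℚ ∘ f) x ≡ ℕtoℚ (sum (λ y → ⟦ collinear S x y ⟧ ℕ.* f y))
  applyA-ℕtoℚ S f x = trans (sumFin-cong entry) (sumFin-ℕtoℚ (λ y → ⟦ collinear S x y ⟧ ℕ.* f y))
    where
    entry : ∀ y → A S x y * ℕtoℚ (f y) ≡ ℕtoℚ (⟦ collinear S x y ⟧ ℕ.* f y)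
    entry y = trans (cong (_* ℕtoℚ (f y)) (A≡ℕtoℚ S x y)) (sym (ℕtoℚ-* ⟦ collinear S x y ⟧ (f y)))

  sumFin-A : ∀ S x → sumFin (A S x) ≡ ℕtoℚ (# collinear S x)
  sumFin-A S x = trans (sumFin-cong (A≡ℕtoℚ S x)) (sumFin-ℕtoℚ (λ y → ⟦ collinear S x y ⟧))

  -- A h = (σ - 1) h for h = τ - c follows from A τ = (σ - 1) τ + σ + 1 once c (σ³ + 1) = σ + 1.
  shifted-eigenvalue : ∀ H F τ σ c → H + σ * (σ * σ + 1ℚ) * c ≡ F → F + τ ≡ σ * τ + (1ℚ + σ) →
                       c * (1ℚ + σ * σ * σ) ≡ 1ℚ + σ → H ≡ (σ - 1ℚ) * (τ - c)
  shifted-eigenvalue H F τ σ c linear affine balance = begin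
    H                                                          ≡⟨ isolate H (σ * (σ * σ + 1ℚ) * c) ⟩
    (H + σ * (σ * σ + 1ℚ) * c) - σ * (σ * σ + 1ℚ) * c         ≡⟨ cong (_- σ * (σ * σ + 1ℚ) * c) linear ⟩
    F - σ * (σ * σ + 1ℚ) * c                                   ≡⟨ isolate′ F τ (σ * (σ * σ + 1ℚ) * c) ⟩
    (F + τ) - τ - σ * (σ * σ + 1ℚ) * c                         ≡⟨ cong (λ k → k - τ - σ * (σ * σ + 1ℚ) * c) affine ⟩
    (σ * τ + (1ℚ + σ)) - τ - σ * (σ * σ + 1ℚ) * c              ≡⟨ regroup σ τ c ⟩
    (σ - 1ℚ) * (τ - c) + ((1ℚ + σ) - c * (1ℚ + σ * σ * σ))     ≡⟨ cong (λ k → (σ - 1ℚ) * (τ - c) + ((1ℚ + σ) - k)) balance ⟩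
    (σ - 1ℚ) * (τ - c) + ((1ℚ + σ) - (1ℚ + σ))                 ≡⟨ drop ((σ - 1ℚ) * (τ - c)) (1ℚ + σ) ⟩
    (σ - 1ℚ) * (τ - c)                                         ∎
    where
    open ≡-Reasoning
    open +-*-Solver
    isolate : ∀ a b → a ≡ (a + b) - b
    isolate = solve 2 (λ a b → a := (a :+ b) :- b) refl
    isolate′ : ∀ a b d → a - d ≡ (a + b) - b - d
    isolate′ = solve 3 (λ a b d → a :- d := (a :+ b) :- b :- d) refl
    regroup : ∀ σ τ c → (σ * τ + (1ℚ + σ)) - τ - σ * (σ * σ + 1ℚ) * c ≡ (σ - 1ℚ) * (τ - c) + ((1ℚ + σ) - c * (1ℚ + σ * σ * σ))
    regroup = solve 3 (λ σ τ c → (σ :* τ :+ (con 1ℚ :+ σ)) :- τ :- σ :* (σ :* σ :+ con 1ℚ) :* c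
                              := (σ :- con 1ℚ) :* (τ :- c) :+ ((con 1ℚ :+ σ) :- c :* (con 1ℚ :+ σ :* σ :* σ))) refl
    drop : ∀ a b → a + (b - b) ≡ a
    drop = solve 2 (λ a b → a :+ (b :- b) := a) refl

  affine⇒WeightedTight : ∀ S s → (∀ x → # collinear S x ≡ s ℕ.* (s ℕ.* s ℕ.+ 1)) → (T : Point S → ℕ) →
    (∀ x → sum (λ y → ⟦ collinear S x y ⟧ ℕ.* T y) ℕ.+ T x ≡ s ℕ.* T x ℕ.+ suc s) →
    WeightedTight S s T
  affine⇒WeightedTight S s regular T affine = (λ _ → c) , (λ x → τ x - c) , constant-eigen , shifted-eigen , split
    where
    σ : ℚ
    σ = ℕtoℚ s
    τ : Point S → ℚ
    τ x = ℕtoℚ (T x)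
    D : ℕ
    D = suc (s ℕ.* s ℕ.* s)
    c : ℚ
    c = ℕtoℚ (suc s) * 1/ ι D
    c-balance : c * (1ℚ + σ * σ * σ) ≡ 1ℚ + σ
    c-balance = begin
      c * (1ℚ + σ * σ * σ)                 ≡⟨ cong (c *_) (sym cube) ⟩
      c * ι D                              ≡⟨ *-assoc (ℕtoℚ (suc s)) (1/ ι D) (ι D) ⟩
      ℕtoℚ (suc s) * (1/ ι D * ι D)        ≡⟨ cong (ℕtoℚ (suc s) *_) (*-inverseˡ (ι D)) ⟩
      ℕtoℚ (suc s) * 1ℚ                    ≡⟨ *-identityʳ (ℕtoℚ (suc s)) ⟩
      ℕtoℚ (suc s)                         ≡⟨ ℕtoℚ-suc s ⟩
      1ℚ + σ                               ∎
      where
      open ≡-Reasoning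
      cube : ι D ≡ 1ℚ + σ * σ * σ
      cube = begin
        ι D                                ≡⟨ sym (ℕtoℚ≡ι D) ⟩
        ℕtoℚ D                             ≡⟨ ℕtoℚ-suc (s ℕ.* s ℕ.* s) ⟩
        1ℚ + ℕtoℚ (s ℕ.* s ℕ.* s)          ≡⟨ cong (1ℚ +_) (trans (ℕtoℚ-* (s ℕ.* s) s) (cong (_* σ) (ℕtoℚ-* s s))) ⟩
        1ℚ + σ * σ * σ                     ∎
    degree : ∀ x → sumFin (A S x) ≡ ℕtoℚ (s ℕ.* (s ℕ.* s ℕ.+ 1))
    degree x = trans (sumFin-A S x) (cong ℕtoℚ (regular x))
    degreeℚ : ℕtoℚ (s ℕ.* (s ℕ.* s ℕ.+ 1)) ≡ σ * (σ * σ + 1ℚ)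
    degreeℚ = trans (ℕtoℚ-* s _) (cong (σ *_) (trans (ℕtoℚ-+ (s ℕ.* s) 1) (cong (_+ 1ℚ) (ℕtoℚ-* s s))))
    constant-eigen : InEigenspace S (ℕtoℚ (s ℕ.* (s ℕ.* s ℕ.+ 1))) (λ _ → c)
    constant-eigen x = begin
      sumFin (λ y → A S x y * c)   ≡⟨ sumFin≡sumℚ (λ y → A S x y * c) ⟩
      sumℚ (λ y → A S x y * c)     ≡⟨ sym (*-distribʳ-sumℚ c (A S x)) ⟩
      sumℚ (A S x) * c             ≡⟨ cong (_* c) (trans (sym (sumFin≡sumℚ (A S x))) (degree x)) ⟩
      ℕtoℚ (s ℕ.* (s ℕ.* s ℕ.+ 1)) * c ∎
      where open ≡-Reasoning
    shifted-eigen : InEigenspace S (σ - 1ℚ) (λ x → τ x - c)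
    shifted-eigen x = shifted-eigenvalue _ _ (τ x) σ c linear affineℚ c-balance
      where
      adj : ℕ
      adj = sum (λ y → ⟦ collinear S x y ⟧ ℕ.* T y)
      linear : applyA S (λ y → τ y - c) x + σ * (σ * σ + 1ℚ) * c ≡ ℕtoℚ adj
      linear = begin
        applyA S (λ y → τ y - c) x + σ * (σ * σ + 1ℚ) * c
          ≡⟨ cong (λ d → applyA S (λ y → τ y - c) x + d * c) (sym (trans (degree x) degreeℚ)) ⟩
        applyA S (λ y → τ y - c) x + sumFin (A S x) * c   ≡⟨ sumFin-shift (A S x) τ c ⟩
        applyA S τ x                                      ≡⟨ applyA-ℕtoℚ S T x ⟩
        ℕtoℚ adj                                          ∎
        where open ≡-Reasoning
      affineℚ : ℕtoℚ adj + τ x ≡ σ * τ x + (1ℚ + σ)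
      affineℚ = begin
        ℕtoℚ adj + τ x                    ≡⟨ sym (ℕtoℚ-+ adj (T x)) ⟩
        ℕtoℚ (adj ℕ.+ T x)                ≡⟨ cong ℕtoℚ (affine x) ⟩
        ℕtoℚ (s ℕ.* T x ℕ.+ suc s)        ≡⟨ ℕtoℚ-+ (s ℕ.* T x) (suc s) ⟩
        ℕtoℚ (s ℕ.* T x) + ℕtoℚ (suc s)   ≡⟨ cong₂ _+_ (ℕtoℚ-* s (T x)) (ℕtoℚ-suc s) ⟩
        σ * τ x + (1ℚ + σ)                ∎
        where open ≡-Reasoning
    split : ∀ x → τ x ≡ c + (τ x - c)
    split x = solve 2 (λ a c → a := c :+ (a :- c)) refl (τ x) c
      where open +-*-Solver

open import Data.Nat using (_+_; _*_; _≤_)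
open import Data.Nat.Properties
  using (+-assoc; *-assoc; +-comm; +-identityʳ; *-identityˡ; *-identityʳ; *-zeroʳ; *-comm;
         *-distribˡ-+; +-cancelˡ-≡; *-cancelʳ-≡; suc-injective; m+n≡0⇒m≡0; m+n≡0⇒n≡0;
         1+n≢0; ∣m-n∣≡0⇒m≡n)
open import Data.Nat.Tactic.RingSolver using (solve-∀)
open import Algebra.Properties.Semiring.Sum +-*-semiring
  using (sum-cong-≗; ∑-distrib-+; ∑-comm; *-distribˡ-sum; *-distribʳ-sum)

-- Finite sums and counting over Fin n

_≢ᵇ_ : ∀ {n} → Fin n → Fin n → Bool
i ≢ᵇ a = not ⌊ i ≟ a ⌋

∧-elim : ∀ {a b} → a ∧ b ≡ true → a ≡ true × b ≡ true
∧-elim {true} {true} _ = refl , refl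

∧-intro : ∀ {a b} → a ≡ true → b ≡ true → a ∧ b ≡ true
∧-intro refl refl = refl

false≢true : ∀ {b} → b ≡ false → b ≡ true → ⊥
false≢true refl ()

⇔⇒≡ : ∀ {a b : Bool} → (a ≡ true → b ≡ true) → (b ≡ true → a ≡ true) → a ≡ b
⇔⇒≡ {true}  f g = sym (f refl)
⇔⇒≡ {false} {true} f g = g refl
⇔⇒≡ {false} {false} f g = refl

⟦∧⟧ : ∀ a b → ⟦ a ∧ b ⟧ ≡ ⟦ a ⟧ * ⟦ b ⟧
⟦∧⟧ true  b = sym (+-identityʳ ⟦ b ⟧)
⟦∧⟧ false b = refl

⌊≟⌋-refl : ∀ {n} (a : Fin n) → ⌊ a ≟ a ⌋ ≡ true
⌊≟⌋-refl a = cong ⌊_⌋ (≡-≟-identity _≟_ refl)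

⌊≟⌋-≢ : ∀ {n} {i a : Fin n} → i ≢ a → ⌊ i ≟ a ⌋ ≡ false
⌊≟⌋-≢ i≢a = cong ⌊_⌋ (≢-≟-identity _≟_ i≢a)

≢ᵇ-true : ∀ {n} {i a : Fin n} → i ≢ᵇ a ≡ true → i ≢ a
≢ᵇ-true {a = a} e refl = false≢true (cong not (⌊≟⌋-refl a)) e

≢ᵇ-intro : ∀ {n} {i a : Fin n} → i ≢ a → i ≢ᵇ a ≡ true
≢ᵇ-intro i≢a = cong not (⌊≟⌋-≢ i≢a)

count≡# : ∀ {n} (P : Fin n → Bool) → count P ≡ # P
count≡# {zero}  P = refl
count≡# {suc n} P = cong (⟦ P zero ⟧ +_) (count≡# (P ∘ suc))

sum-zero : ∀ {n} {f : Fin n → ℕ} → (∀ i → f i ≡ 0) → sum f ≡ 0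
sum-zero {zero}  f≡0 = refl
sum-zero {suc n} f≡0 = cong₂ _+_ (f≡0 zero) (sum-zero (f≡0 ∘ suc))

sum≡0⇒≡0 : ∀ {n} (f : Fin n → ℕ) → sum f ≡ 0 → ∀ i → f i ≡ 0
sum≡0⇒≡0 f Σ≡0 zero    = m+n≡0⇒m≡0 (f zero) Σ≡0
sum≡0⇒≡0 f Σ≡0 (suc i) = sum≡0⇒≡0 (f ∘ suc) (m+n≡0⇒n≡0 (f zero) Σ≡0) i

sum-*ʳ : ∀ {n} (f : Fin n → ℕ) c → sum (λ i → f i * c) ≡ sum f * c
sum-*ʳ f c = sym (*-distribʳ-sum c f)

sum-*ˡ : ∀ {n} c (f : Fin n → ℕ) → sum (λ i → c * f i) ≡ c * sum f
sum-*ˡ c f = sym (*-distribˡ-sum c f)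

sum-concentrated : ∀ {n} (f : Fin n → ℕ) a → (∀ i → i ≢ a → f i ≡ 0) → sum f ≡ f a
sum-concentrated f zero f≡0 =
  trans (cong (f zero +_) (sum-zero (λ i → f≡0 (suc i) λ ()))) (+-identityʳ (f zero))
sum-concentrated f (suc a) f≡0 =
  cong₂ _+_ (f≡0 zero λ ()) (sum-concentrated (f ∘ suc) a (λ i i≢a → f≡0 (suc i) (i≢a ∘ Fin-suc-injective)))

sum-remove : ∀ {n} (f : Fin n → ℕ) a → sum f ≡ f a + sum (λ i → ⟦ i ≢ᵇ a ⟧ * f i)
sum-remove f a = begin
  sum f                                    ≡⟨ sum-cong-≗ split ⟩
  sum (λ i → at-a i + off-a i)             ≡⟨ ∑-distrib-+ at-a off-a ⟩
  sum at-a + sum off-a                     ≡⟨ cong (_+ sum off-a) (sum-concentrated at-a a at-a≡0) ⟩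
  ⟦ ⌊ a ≟ a ⌋ ⟧ * f a + sum off-a          ≡⟨ cong (λ b → ⟦ b ⟧ * f a + sum off-a) (⌊≟⌋-refl a) ⟩
  1 * f a + sum off-a                      ≡⟨ cong (_+ sum off-a) (*-identityˡ (f a)) ⟩
  f a + sum off-a                          ∎
  where
  open ≡-Reasoning
  at-a off-a : Fin _ → ℕ
  at-a i = ⟦ ⌊ i ≟ a ⌋ ⟧ * f i
  off-a i = ⟦ i ≢ᵇ a ⟧ * f i
  split : ∀ i → f i ≡ at-a i + off-a i
  split i with i ≟ a
  ... | yes _ = sym (trans (+-identityʳ _) (+-identityʳ _))
  ... | no _  = sym (+-identityʳ _)
  at-a≡0 : ∀ i → i ≢ a → at-a i ≡ 0
  at-a≡0 i i≢a = cong (λ b → ⟦ b ⟧ * f i) (⌊≟⌋-≢ i≢a)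

#-unique : ∀ {n} (P : Fin n → Bool) a → P a ≡ true → (∀ b → P b ≡ true → b ≡ a) → # P ≡ 1
#-unique P a Pa unique = trans (sum-concentrated _ a off-a) (cong ⟦_⟧ Pa)
  where
  off-a : ∀ i → i ≢ a → ⟦ P i ⟧ ≡ 0
  off-a i i≢a with P i in Pi
  ... | true  = ⊥-elim (i≢a (unique i Pi))
  ... | false = refl

#-empty : ∀ {n} (P : Fin n → Bool) → (∀ b → P b ≡ true → ⊥) → # P ≡ 0
#-empty P none = sum-zero zero-at
  where
  zero-at : ∀ i → ⟦ P i ⟧ ≡ 0
  zero-at i with P i in Pi
  ... | true  = ⊥-elim (none i Pi)
  ... | false = refl

#≡1⇒unique : ∀ {n} (P : Fin n → Bool) {a b} → # P ≡ 1 → P a ≡ true → P b ≡ true → a ≡ b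
#≡1⇒unique P {a} {b} #P≡1 Pa Pb with a ≟ b
... | yes a≡b = a≡b
... | no  a≢b = ⊥-elim (1+n≢0 (+-cancelˡ-≡ 1 _ 0 (trans (sym two) #P≡1)))
  where
  others : Fin _ → ℕ
  others i = ⟦ i ≢ᵇ a ⟧ * ⟦ P i ⟧
  two : # P ≡ 1 + (1 + sum (λ i → ⟦ i ≢ᵇ b ⟧ * others i))
  two = begin
    # P                                                 ≡⟨ sum-remove _ a ⟩
    ⟦ P a ⟧ + sum others                                ≡⟨ cong₂ _+_ (cong ⟦_⟧ Pa) (sum-remove others b) ⟩
    1 + (others b + sum (λ i → ⟦ i ≢ᵇ b ⟧ * others i))   ≡⟨ cong (λ k → 1 + (k + sum (λ i → ⟦ i ≢ᵇ b ⟧ * others i))) others-b ⟩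
    1 + (1 + sum (λ i → ⟦ i ≢ᵇ b ⟧ * others i))          ∎
    where
    open ≡-Reasoning
    others-b : others b ≡ 1
    others-b rewrite ≢ᵇ-intro (a≢b ∘ sym) | Pb = refl

#-split : ∀ {n} (P Q : Fin n → Bool) → # P ≡ # (λ i → P i ∧ Q i) + # (λ i → P i ∧ not (Q i))
#-split P Q = trans (sum-cong-≗ split) (∑-distrib-+ (λ i → ⟦ P i ∧ Q i ⟧) (λ i → ⟦ P i ∧ not (Q i) ⟧))
  where
  split : ∀ i → ⟦ P i ⟧ ≡ ⟦ P i ∧ Q i ⟧ + ⟦ P i ∧ not (Q i) ⟧
  split i with P i | Q i
  ... | true  | true  = refl
  ... | true  | false = refl
  ... | false | _     = refl

sum-const-on : ∀ {n} (P : Fin n → Bool) (f : Fin n → ℕ) c → (∀ i → P i ≡ true → f i ≡ c) →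
               sum (λ i → ⟦ P i ⟧ * f i) ≡ # P * c
sum-const-on P f c f≡c = trans (sum-cong-≗ on-P) (sum-*ʳ (λ i → ⟦ P i ⟧) c)
  where
  on-P : ∀ i → ⟦ P i ⟧ * f i ≡ ⟦ P i ⟧ * c
  on-P i with P i in Pi
  ... | true  = cong (_+ 0) (f≡c i Pi)
  ... | false = refl

double-count : ∀ {m n} (P : Fin m → Bool) (Q : Fin n → Bool) (E : Fin m → Fin n → Bool) →
  sum (λ i → ⟦ P i ⟧ * # (λ j → E i j ∧ Q j)) ≡ sum (λ j → ⟦ Q j ⟧ * # (λ i → E i j ∧ P i))
double-count P Q E = begin
  sum (λ i → ⟦ P i ⟧ * # (λ j → E i j ∧ Q j))              ≡⟨ sum-cong-≗ (λ i → sym (sum-*ˡ ⟦ P i ⟧ (λ j → ⟦ E i j ∧ Q j ⟧))) ⟩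
  sum (λ i → sum (λ j → ⟦ P i ⟧ * ⟦ E i j ∧ Q j ⟧))        ≡⟨ ∑-comm (λ i j → ⟦ P i ⟧ * ⟦ E i j ∧ Q j ⟧) ⟩
  sum (λ j → sum (λ i → ⟦ P i ⟧ * ⟦ E i j ∧ Q j ⟧))        ≡⟨ sum-cong-≗ (λ j → sum-cong-≗ (λ i → swap (P i) (Q j) (E i j))) ⟩
  sum (λ j → sum (λ i → ⟦ Q j ⟧ * ⟦ E i j ∧ P i ⟧))        ≡⟨ sum-cong-≗ (λ j → sum-*ˡ ⟦ Q j ⟧ (λ i → ⟦ E i j ∧ P i ⟧)) ⟩
  sum (λ j → ⟦ Q j ⟧ * # (λ i → E i j ∧ P i))              ∎
  where
  open ≡-Reasoning
  swap : ∀ p q e → ⟦ p ⟧ * ⟦ e ∧ q ⟧ ≡ ⟦ q ⟧ * ⟦ e ∧ p ⟧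
  swap true  true  e     = refl
  swap true  false true  = refl
  swap true  false false = refl
  swap false true  true  = refl
  swap false true  false = refl
  swap false false e     = refl

square-expansion : ∀ a m → a * a + m * m ≡ 2 * m * a + ℕ.∣ a - m ∣ * ℕ.∣ a - m ∣
square-expansion zero    m       = cong (_+ m * m) (sym (*-zeroʳ (2 * m)))
square-expansion (suc a) zero    = +-identityʳ (suc a * suc a)
square-expansion (suc a) (suc m) = begin
  suc a * suc a + suc m * suc m               ≡⟨ shift a m ⟩
  (a * a + m * m) + 2 * (1 + a + m)           ≡⟨ cong (_+ 2 * (1 + a + m)) (square-expansion a m) ⟩
  (2 * m * a + d * d) + 2 * (1 + a + m)       ≡⟨ unshift a m (d * d) ⟩
  2 * suc m * suc a + d * d                   ∎
  where
  open ≡-Reasoning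
  d = ℕ.∣ a - m ∣
  shift : ∀ a m → suc a * suc a + suc m * suc m ≡ (a * a + m * m) + 2 * (1 + a + m)
  shift = solve-∀
  unshift : ∀ a m e → (2 * m * a + e) + 2 * (1 + a + m) ≡ 2 * suc m * suc a + e
  unshift = solve-∀

-- Σ_Z (f - m)² = 0, with the square expanded so that no subtraction occurs.
zero-variance⇒constant : ∀ {n} (Z : Fin n → Bool) (f : Fin n → ℕ) m →
  sum (λ i → ⟦ Z i ⟧ * (f i * f i)) + # Z * (m * m) ≡ 2 * m * sum (λ i → ⟦ Z i ⟧ * f i) →
  ∀ i → Z i ≡ true → f i ≡ m
zero-variance⇒constant Z f m variance i Zi =
  ∣m-n∣≡0⇒m≡n (square≡0 (trans (sym (+-identityʳ (dev i))) (subst (λ b → ⟦ b ⟧ * dev i ≡ 0) Zi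
    (sum≡0⇒≡0 (λ i → ⟦ Z i ⟧ * dev i) Σdev≡0 i))))
  where
  dev : Fin _ → ℕ
  dev i = ℕ.∣ f i - m ∣ * ℕ.∣ f i - m ∣
  square≡0 : ∀ {d} → d * d ≡ 0 → d ≡ 0
  square≡0 {zero} _ = refl
  pointwise : ∀ i → ⟦ Z i ⟧ * (f i * f i) + ⟦ Z i ⟧ * (m * m) ≡ 2 * m * (⟦ Z i ⟧ * f i) + ⟦ Z i ⟧ * dev i
  pointwise i = begin
    ⟦ Z i ⟧ * (f i * f i) + ⟦ Z i ⟧ * (m * m) ≡⟨ sym (*-distribˡ-+ ⟦ Z i ⟧ (f i * f i) (m * m)) ⟩
    ⟦ Z i ⟧ * (f i * f i + m * m)             ≡⟨ cong (⟦ Z i ⟧ *_) (square-expansion (f i) m) ⟩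
    ⟦ Z i ⟧ * (2 * m * f i + dev i)           ≡⟨ distribute ⟦ Z i ⟧ m (f i) (dev i) ⟩
    2 * m * (⟦ Z i ⟧ * f i) + ⟦ Z i ⟧ * dev i ∎
    where
    open ≡-Reasoning
    distribute : ∀ z m f d → z * (2 * m * f + d) ≡ 2 * m * (z * f) + z * d
    distribute = solve-∀
  expanded : sum (λ i → ⟦ Z i ⟧ * (f i * f i)) + # Z * (m * m) ≡
             2 * m * sum (λ i → ⟦ Z i ⟧ * f i) + sum (λ i → ⟦ Z i ⟧ * dev i)
  expanded = begin
    sum (λ i → ⟦ Z i ⟧ * (f i * f i)) + # Z * (m * m)
      ≡⟨ cong (sum (λ i → ⟦ Z i ⟧ * (f i * f i)) +_) (sym (sum-*ʳ (λ i → ⟦ Z i ⟧) (m * m))) ⟩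
    sum (λ i → ⟦ Z i ⟧ * (f i * f i)) + sum (λ i → ⟦ Z i ⟧ * (m * m))
      ≡⟨ sym (∑-distrib-+ (λ i → ⟦ Z i ⟧ * (f i * f i)) (λ i → ⟦ Z i ⟧ * (m * m))) ⟩
    sum (λ i → ⟦ Z i ⟧ * (f i * f i) + ⟦ Z i ⟧ * (m * m))
      ≡⟨ sum-cong-≗ pointwise ⟩
    sum (λ i → 2 * m * (⟦ Z i ⟧ * f i) + ⟦ Z i ⟧ * dev i)
      ≡⟨ ∑-distrib-+ (λ i → 2 * m * (⟦ Z i ⟧ * f i)) (λ i → ⟦ Z i ⟧ * dev i) ⟩
    sum (λ i → 2 * m * (⟦ Z i ⟧ * f i)) + sum (λ i → ⟦ Z i ⟧ * dev i)
      ≡⟨ cong (_+ sum (λ i → ⟦ Z i ⟧ * dev i)) (sum-*ˡ (2 * m) (λ i → ⟦ Z i ⟧ * f i)) ⟩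
    2 * m * sum (λ i → ⟦ Z i ⟧ * f i) + sum (λ i → ⟦ Z i ⟧ * dev i) ∎
    where open ≡-Reasoning
  Σdev≡0 : sum (λ i → ⟦ Z i ⟧ * dev i) ≡ 0
  Σdev≡0 = +-cancelˡ-≡ (2 * m * sum (λ i → ⟦ Z i ⟧ * f i)) _ 0
             (trans (sym expanded) (trans variance (sym (+-identityʳ _))))

sum-*-square : ∀ {m n} (c : Fin m → ℕ) (a : Fin m → Fin n → ℕ) →
  sum (λ z → c z * (sum (a z) * sum (a z))) ≡ sum (λ w₁ → sum (λ w₂ → sum (λ z → c z * (a z w₁ * a z w₂))))
sum-*-square c a = begin
  sum (λ z → c z * (sum (a z) * sum (a z)))                   ≡⟨ sum-cong-≗ expand ⟩
  sum (λ z → sum (λ w₁ → sum (λ w₂ → c z * (a z w₁ * a z w₂)))) ≡⟨ ∑-comm (λ z w₁ → sum (λ w₂ → c z * (a z w₁ * a z w₂))) ⟩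
  sum (λ w₁ → sum (λ z → sum (λ w₂ → c z * (a z w₁ * a z w₂)))) ≡⟨ sum-cong-≗ (λ w₁ → ∑-comm (λ z w₂ → c z * (a z w₁ * a z w₂))) ⟩
  sum (λ w₁ → sum (λ w₂ → sum (λ z → c z * (a z w₁ * a z w₂)))) ∎
  where
  open ≡-Reasoning
  expand : ∀ z → c z * (sum (a z) * sum (a z)) ≡ sum (λ w₁ → sum (λ w₂ → c z * (a z w₁ * a z w₂)))
  expand z = begin
    c z * (sum (a z) * sum (a z))                             ≡⟨ cong (c z *_) (sym (sum-*ʳ (a z) (sum (a z)))) ⟩
    c z * sum (λ w₁ → a z w₁ * sum (a z))                     ≡⟨ sym (sum-*ˡ (c z) (λ w₁ → a z w₁ * sum (a z))) ⟩
    sum (λ w₁ → c z * (a z w₁ * sum (a z)))                   ≡⟨ sum-cong-≗ (λ w₁ → cong (c z *_) (sym (sum-*ˡ (a z w₁) (a z)))) ⟩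
    sum (λ w₁ → c z * sum (λ w₂ → a z w₁ * a z w₂))           ≡⟨ sum-cong-≗ (λ w₁ → sym (sum-*ˡ (c z) (λ w₂ → a z w₁ * a z w₂))) ⟩
    sum (λ w₁ → sum (λ w₂ → c z * (a z w₁ * a z w₂)))         ∎

anyFin⇒∃ : ∀ {n} (P : Fin n → Bool) → anyFin P ≡ true → ∃[ i ] P i ≡ true
anyFin⇒∃ {suc n} P any with P zero in P0
... | true  = zero , P0
... | false with anyFin⇒∃ (P ∘ suc) any
...   | i , Pi = suc i , Pi

∃⇒anyFin : ∀ {n} (P : Fin n → Bool) i → P i ≡ true → anyFin P ≡ true
∃⇒anyFin P zero    Pi rewrite Pi = refl
∃⇒anyFin P (suc i) Pi rewrite ∃⇒anyFin (P ∘ suc) i Pi = ∨-zeroʳ (P zero)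

-- Generalised quadrangles

module Quadrangle (S : IncStr) {s t : ℕ} (G : IsGQ S s t) where
  open IncStr S
  open IsGQ G

  col : Point S → Point S → Bool
  col = collinear S

  col⇒line : ∀ {p q} → col p q ≡ true → p ≢ q × ∃[ l ] (I p l ≡ true × I q l ≡ true)
  col⇒line {p} {q} pq with ∧-elim {not ⌊ p ≟ q ⌋} pq
  ... | p≢q , some-line with anyFin⇒∃ (λ l → I p l ∧ I q l) some-line
  ...   | l , on-l = ≢ᵇ-true p≢q , l , ∧-elim on-l

  line⇒col : ∀ {p q l} → p ≢ q → I p l ≡ true → I q l ≡ true → col p q ≡ true
  line⇒col {p} {q} {l} p≢q pl ql =
    ∧-intro (≢ᵇ-intro p≢q) (∃⇒anyFin (λ l → I p l ∧ I q l) l (∧-intro pl ql))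

  col-sym : ∀ p q → col p q ≡ col q p
  col-sym p q = ⇔⇒≡ flip flip
    where
    flip : ∀ {p q} → col p q ≡ true → col q p ≡ true
    flip pq with col⇒line pq
    ... | p≢q , l , pl , ql = line⇒col (p≢q ∘ sym) ql pl

  col-flip : ∀ {p q b} → col p q ≡ b → col q p ≡ b
  col-flip {p} {q} = trans (col-sym q p)

  col-irrefl : ∀ p → col p p ≡ false
  col-irrefl p with col p p in pp
  ... | true  = ⊥-elim (proj₁ (col⇒line pp) refl)
  ... | false = refl

  ≡-or-col : ∀ {p q l} → I p l ≡ true → I q l ≡ true → p ≡ q ⊎ col p q ≡ true
  ≡-or-col {p} {q} pl ql = decide (p ≟ q)
    where
    decide : Dec (p ≡ q) → p ≡ q ⊎ col p q ≡ true
    decide (yes p≡q) = inj₁ p≡q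
    decide (no  p≢q) = inj₂ (line⇒col p≢q pl ql)

  -- A point off l is collinear with only one point of l, so there are no triangles.
  triangle-on-line : ∀ {w p q l} → col w p ≡ true → col p q ≡ true → col q w ≡ true →
                     I w l ≡ true → I p l ≡ true → I q l ≡ true
  triangle-on-line {w} {p} {q} {l} wp pq qw wl pl with I q l in ql
  ... | true  = refl
  ... | false = ⊥-elim (proj₁ (col⇒line wp)
         (#≡1⇒unique (λ r → I r l ∧ col q r)
           (trans (sym (count≡# (λ r → I r l ∧ col q r))) (gq-axiom q l ql))
           (∧-intro wl qw) (∧-intro pl (col-flip pq))))

  #-others-on : ∀ {p l} → I p l ≡ true → # (λ q → I q l ∧ q ≢ᵇ p) ≡ s
  #-others-on {p} {l} pl = suc-injective (begin
    suc (# (λ q → I q l ∧ q ≢ᵇ p))                     ≡⟨ cong suc (sum-cong-≗ λ q → trans (⟦∧⟧ (I q l) _) (*-comm ⟦ I q l ⟧ _)) ⟩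
    suc (sum (λ q → ⟦ q ≢ᵇ p ⟧ * ⟦ I q l ⟧))            ≡⟨ cong (λ b → ⟦ b ⟧ + sum (λ q → ⟦ q ≢ᵇ p ⟧ * ⟦ I q l ⟧)) (sym pl) ⟩
    ⟦ I p l ⟧ + sum (λ q → ⟦ q ≢ᵇ p ⟧ * ⟦ I q l ⟧)      ≡⟨ sym (sum-remove (λ q → ⟦ I q l ⟧) p) ⟩
    # (λ q → I q l)                                    ≡⟨ sym (count≡# (λ q → I q l)) ⟩
    count (λ q → I q l)                                ≡⟨ line-size l ⟩
    suc s                                              ∎)
    where open ≡-Reasoning

  #-via-lines-through : ∀ p (R : Point S → Bool) (Q : Fin nl → Point S → Bool) c →
    (∀ q → ⟦ R q ⟧ ≡ sum (λ l → ⟦ I p l ∧ Q l q ⟧)) → (∀ l → I p l ≡ true → # Q l ≡ c) →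
    # R ≡ suc t * c
  #-via-lines-through p R Q c R-via #Q≡c = begin
    # R                                                   ≡⟨ sum-cong-≗ R-via ⟩
    sum (λ q → sum (λ l → ⟦ I p l ∧ Q l q ⟧))             ≡⟨ ∑-comm (λ q l → ⟦ I p l ∧ Q l q ⟧) ⟩
    sum (λ l → sum (λ q → ⟦ I p l ∧ Q l q ⟧))
      ≡⟨ sum-cong-≗ (λ l → trans (sum-cong-≗ (λ q → ⟦∧⟧ (I p l) (Q l q))) (sum-*ˡ ⟦ I p l ⟧ (λ q → ⟦ Q l q ⟧))) ⟩
    sum (λ l → ⟦ I p l ⟧ * # Q l)                         ≡⟨ sum-const-on (I p) (λ l → # Q l) c #Q≡c ⟩
    # (I p) * c                                           ≡⟨ cong (_* c) (trans (sym (count≡# (I p))) (point-deg p)) ⟩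
    suc t * c                                             ∎
    where open ≡-Reasoning

  degree : ∀ p → # (col p) ≡ suc t * s
  degree p = #-via-lines-through p (col p) (λ l q → I q l ∧ q ≢ᵇ p) s via (λ l pl → #-others-on pl)
    where
    via : ∀ q → ⟦ col p q ⟧ ≡ sum (λ l → ⟦ I p l ∧ (I q l ∧ q ≢ᵇ p) ⟧)
    via q with col p q in pq
    ... | true with col⇒line pq
    ...   | p≢q , m , pm , qm = sym (#-unique _ m (∧-intro pm (∧-intro qm (≢ᵇ-intro (p≢q ∘ sym))))
             λ l on-l → let pl , ql,q≢p = ∧-elim on-l in
                        one-line p q l m p≢q pl (proj₁ (∧-elim {I q l} ql,q≢p)) pm qm)
    via q | false = sym (#-empty _ λ l on-l → let pl , ql,q≢p = ∧-elim on-l ; ql , q≢p = ∧-elim {I q l} ql,q≢p in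
             false≢true pq (line⇒col (≢ᵇ-true q≢p ∘ sym) pl ql))

  #-trace : ∀ {a b} → a ≢ b → col a b ≡ false → # (λ w → col w a ∧ col w b) ≡ suc t
  #-trace {a} {b} a≢b a≁b =
    trans (#-via-lines-through a _ (λ l w → I w l ∧ col b w) 1 via #-on-line) (*-identityʳ (suc t))
    where
    via : ∀ w → ⟦ col w a ∧ col w b ⟧ ≡ sum (λ l → ⟦ I a l ∧ (I w l ∧ col b w) ⟧)
    via w with col w a ∧ col w b in wab
    ... | true with ∧-elim {col w a} wab
    ...   | wa , wb with col⇒line wa
    ...     | w≢a , m , wm , am = sym (#-unique _ m (∧-intro am (∧-intro wm (col-flip wb)))
               λ l on-l → let al , wl,bw = ∧-elim on-l in one-line w a l m w≢a (proj₁ (∧-elim {I w l} wl,bw)) al wm am)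
    via w | false = sym (#-empty _ none)
      where
      none : ∀ l → (I a l ∧ (I w l ∧ col b w)) ≡ true → ⊥
      none l on-l with ∧-elim {I a l} on-l
      ... | al , wl,bw with ∧-elim {I w l} wl,bw
      ...   | wl , bw with ≡-or-col wl al
      ...     | inj₁ refl = false≢true a≁b (col-flip bw)
      ...     | inj₂ wa   = false≢true wab (∧-intro wa (col-flip bw))
    #-on-line : ∀ l → I a l ≡ true → # (λ w → I w l ∧ col b w) ≡ 1
    #-on-line l al with I b l in bl
    ... | true  = ⊥-elim (false≢true a≁b (line⇒col a≢b al bl))
    ... | false = trans (sym (count≡# (λ w → I w l ∧ col b w))) (gq-axiom b l bl)

  -- q ∈ p^⊥, which in a generalised quadrangle contains p itself
  perp : Point S → Point S → Bool
  perp p q = ⌊ q ≟ p ⌋ ∨ col q p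

  perp-elim : ∀ {p q} → perp p q ≡ true → q ≡ p ⊎ col q p ≡ true
  perp-elim {p} {q} = decide (q ≟ p)
    where
    decide : (q≟p : Dec (q ≡ p)) → (⌊ q≟p ⌋ ∨ col q p) ≡ true → q ≡ p ⊎ col q p ≡ true
    decide (yes q≡p) _  = inj₁ q≡p
    decide (no  _)   qp = inj₂ qp

  perp-refl : ∀ p → perp p p ≡ true
  perp-refl p = cong (_∨ col p p) (⌊≟⌋-refl p)

  col⇒perp : ∀ {p q} → col q p ≡ true → perp p q ≡ true
  col⇒perp {p} {q} qp = trans (cong (⌊ q ≟ p ⌋ ∨_) qp) (∨-zeroʳ _)

  ¬perp : ∀ {p q} → q ≢ p → col q p ≡ false → perp p q ≡ false
  ¬perp q≢p q≁p = cong₂ _∨_ (⌊≟⌋-≢ q≢p) q≁p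

  ¬perp⇒≢ : ∀ {p q} → perp p q ≡ false → q ≢ p
  ¬perp⇒≢ {p} ¬pq refl = false≢true ¬pq (perp-refl p)

  ¬perp⇒¬col : ∀ {p q} → perp p q ≡ false → col q p ≡ false
  ¬perp⇒¬col {p} {q} ¬pq = decide (col q p) refl
    where
    decide : ∀ b → col q p ≡ b → col q p ≡ false
    decide true  qp = ⊥-elim (false≢true ¬pq (col⇒perp qp))
    decide false qp = qp

  -- The points of w^⊥ ∩ p^⊥ other than w are those of the line wp.
  #-line-perp : ∀ {w p} → col w p ≡ true → # (λ q → col w q ∧ perp p q) ≡ s
  #-line-perp {w} {p} wp with col⇒line wp
  ... | w≢p , l , wl , pl = trans (sum-cong-≗ (λ q → cong ⟦_⟧ (⇔⇒≡ (to q) (from q)))) (#-others-on wl)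
    where
    to : ∀ q → (col w q ∧ perp p q) ≡ true → (I q l ∧ q ≢ᵇ w) ≡ true
    to q wq,pq with ∧-elim {col w q} wq,pq
    ... | wq , pq with perp-elim {p} {q} pq
    ...   | inj₁ refl = ∧-intro pl (≢ᵇ-intro (proj₁ (col⇒line wq) ∘ sym))
    ...   | inj₂ qp   = ∧-intro (triangle-on-line wp (col-flip qp) (col-flip wq) wl pl)
                                (≢ᵇ-intro (proj₁ (col⇒line wq) ∘ sym))
    from : ∀ q → (I q l ∧ q ≢ᵇ w) ≡ true → (col w q ∧ perp p q) ≡ true
    from q ql,q≢w with ∧-elim {I q l} ql,q≢w
    ... | ql , q≢w with ≡-or-col ql pl
    ...   | inj₁ refl = ∧-intro (line⇒col (≢ᵇ-true q≢w ∘ sym) wl ql) (perp-refl q)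
    ...   | inj₂ qp   = ∧-intro (line⇒col (≢ᵇ-true q≢w ∘ sym) wl ql) (col⇒perp qp)

  unique-centre : ∀ {a b z} → a ≢ b → col a b ≡ false → col z a ≡ true → col z b ≡ false →
                  # (λ w → col z w ∧ (col w a ∧ col w b)) ≡ 1
  unique-centre {a} {b} {z} a≢b a≁b za z≁b with col⇒line za
  ... | z≢a , l , zl , al =
    trans (sum-cong-≗ (λ w → cong ⟦_⟧ (⇔⇒≡ (to w) (from w))))
          (trans (sym (count≡# (λ w → I w l ∧ col b w))) (gq-axiom b l b∉l))
    where
    b∉l : I b l ≡ false
    b∉l with I b l in bl
    ... | true  = ⊥-elim (false≢true a≁b (line⇒col a≢b al bl))
    ... | false = refl
    to : ∀ w → (col z w ∧ (col w a ∧ col w b)) ≡ true → (I w l ∧ col b w) ≡ true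
    to w zw,wa,wb with ∧-elim {col z w} zw,wa,wb
    ... | zw , wa,wb with ∧-elim {col w a} wa,wb
    ...   | wa , wb = ∧-intro (triangle-on-line za (col-flip wa) (col-flip zw) zl al) (col-flip wb)
    from : ∀ w → (I w l ∧ col b w) ≡ true → (col z w ∧ (col w a ∧ col w b)) ≡ true
    from w wl,bw with ∧-elim {I w l} wl,bw
    ... | wl , bw with ≡-or-col wl zl | ≡-or-col wl al
    ...   | inj₁ refl | _         = ⊥-elim (false≢true z≁b (col-flip bw))
    ...   | inj₂ _    | inj₁ refl = ⊥-elim (false≢true a≁b (col-flip bw))
    ...   | inj₂ wz   | inj₂ wa   = ∧-intro (col-flip wz) (∧-intro wa (col-flip bw))

  perp-pair-coclique : ∀ {w₁ w₂ z a} → w₁ ≢ w₂ → col w₁ w₂ ≡ false →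
    col z w₁ ≡ true → col z w₂ ≡ true → col w₁ a ≡ true → col w₂ a ≡ true → z ≢ a → col z a ≡ false
  perp-pair-coclique {w₁} {w₂} {z} {a} w₁≢w₂ w₁≁w₂ zw₁ zw₂ w₁a w₂a z≢a with col z a in za
  ... | false = refl
  ... | true with col⇒line w₁a | col⇒line w₂a
  ...   | _ , l , w₁l , al | _ , m , w₂m , am = ⊥-elim (false≢true w₁≁w₂ (line⇒col w₁≢w₂ w₁l w₂l))
    where
    l≡m : l ≡ m
    l≡m = one-line z a l m z≢a (triangle-on-line w₁a (col-flip za) zw₁ w₁l al) al
                                (triangle-on-line w₂a (col-flip za) zw₂ w₂m am) am
    w₂l : I w₂ l ≡ true
    w₂l = subst (λ k → I w₂ k ≡ true) (sym l≡m) w₂m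

  -- Double count the pairs (q, w) with q ∉ p^⊥ and w ∈ {p, q}^⊥.
  #-not-perp : ∀ p Y₀ → suc t * s ≡ s + Y₀ → # (λ q → not (perp p q)) ≡ s * Y₀
  #-not-perp p Y₀ Y₀-def = *-cancelʳ-≡ (# far) (s * Y₀) (suc t) (begin
    # far * suc t                                          ≡⟨ sym (sum-*ʳ (λ q → ⟦ far q ⟧) (suc t)) ⟩
    sum (λ q → ⟦ far q ⟧ * suc t)                          ≡⟨ sum-cong-≗ by-trace ⟩
    sum (λ q → ⟦ far q ⟧ * # (λ w → col w q ∧ col w p))    ≡⟨ double-count far (λ w → col w p) (λ q w → col w q) ⟩
    sum (λ w → ⟦ col w p ⟧ * # (λ q → col w q ∧ far q))
      ≡⟨ sum-const-on (λ w → col w p) (λ w → # (λ q → col w q ∧ far q)) Y₀ #far-nbrs ⟩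
    # (λ w → col w p) * Y₀
      ≡⟨ cong (_* Y₀) (trans (sum-cong-≗ λ w → cong ⟦_⟧ (col-sym w p)) (degree p)) ⟩
    suc t * s * Y₀                                         ≡⟨ rotate (suc t) s Y₀ ⟩
    s * Y₀ * suc t                                         ∎)
    where
    open ≡-Reasoning
    far : Point S → Bool
    far q = not (perp p q)
    rotate : ∀ a b c → a * b * c ≡ b * c * a
    rotate = solve-∀
    by-trace : ∀ q → ⟦ far q ⟧ * suc t ≡ ⟦ far q ⟧ * # (λ w → col w q ∧ col w p)
    by-trace q with perp p q in pq
    ... | true  = refl
    ... | false = cong (1 *_) (sym (#-trace (¬perp⇒≢ pq) (¬perp⇒¬col pq)))
    #far-nbrs : ∀ w → col w p ≡ true → # (λ q → col w q ∧ far q) ≡ Y₀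
    #far-nbrs w wp = +-cancelˡ-≡ s (# (λ q → col w q ∧ far q)) Y₀ (begin
      s + # (λ q → col w q ∧ far q)                                ≡⟨ cong (_+ # (λ q → col w q ∧ far q)) (sym (#-line-perp wp)) ⟩
      # (λ q → col w q ∧ perp p q) + # (λ q → col w q ∧ far q)     ≡⟨ sym (#-split (col w) (perp p)) ⟩
      # (col w)                                                    ≡⟨ degree w ⟩
      suc t * s                                                    ≡⟨ Y₀-def ⟩
      s + Y₀                                                       ∎)

  module Trace {x y : Point S} (x≢y : x ≢ y) (x≁y : col x y ≡ false) where

    trace : Point S → Bool
    trace w = col w x ∧ col w y

    outside : Point S → Bool
    outside z = not (perp x z) ∧ not (perp y z)

    traceDegree : Point S → ℕ
    traceDegree z = sum (λ w → ⟦ col z w ⟧ * ⟦ trace w ⟧)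

    traceDegree≡# : ∀ z → traceDegree z ≡ # (λ w → col z w ∧ trace w)
    traceDegree≡# z = sum-cong-≗ (λ w → sym (⟦∧⟧ (col z w) (trace w)))

    trace-coclique : ∀ {w z} → trace w ≡ true → trace z ≡ true → col w z ≡ false
    trace-coclique {w} {z} w∈tr z∈tr with col w z in wz
    ... | false = refl
    ... | true with ∧-elim {col w x} w∈tr | ∧-elim {col z x} z∈tr
    ...   | wx , wy | zx , zy with col⇒line wx
    ...     | _ , l , wl , xl = ⊥-elim (false≢true x≁y (line⇒col x≢y xl yl))
      where
      zl : I z l ≡ true
      zl = triangle-on-line wx (col-flip zx) (col-flip wz) wl xl
      yl : I y l ≡ true
      yl = triangle-on-line wz zy (col-flip wy) wl zl

    trace-nbr-not-perp-both : ∀ {w z} → trace w ≡ true → col w z ≡ true → perp x z ≡ true → perp y z ≡ false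
    trace-nbr-not-perp-both {w} {z} w∈tr wz xz with perp y z in yz
    ... | false = refl
    ... | true with perp-elim {x} {z} xz | perp-elim {y} {z} yz
    ...   | inj₁ refl | inj₁ refl = ⊥-elim (x≢y refl)
    ...   | inj₁ refl | inj₂ zy   = ⊥-elim (false≢true x≁y zy)
    ...   | inj₂ zx   | inj₁ refl = ⊥-elim (false≢true x≁y (col-flip zx))
    ...   | inj₂ zx   | inj₂ zy   = ⊥-elim (false≢true (trace-coclique w∈tr (∧-intro zx zy)) wz)

    -- w^⊥ meets x^⊥ and y^⊥ in the s further points of the lines wx and wy.
    outside-nbrs-of-trace : ∀ {w} → trace w ≡ true → suc t * s ≡ s + s + # (λ z → col w z ∧ outside z)
    outside-nbrs-of-trace {w} w∈tr with ∧-elim {col w x} w∈tr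
    ... | wx , wy = begin
      suc t * s                                             ≡⟨ sym (degree w) ⟩
      # (col w)                                             ≡⟨ #-split (col w) (perp x) ⟩
      # (λ z → col w z ∧ perp x z) + # off-x                ≡⟨ cong₂ _+_ (#-line-perp wx) (#-split off-x (perp y)) ⟩
      s + (# (λ z → off-x z ∧ perp y z) + # off-xy)          ≡⟨ cong (λ k → s + (k + # off-xy)) #on-y ⟩
      s + (s + # off-xy)                                    ≡⟨ sym (+-assoc s s (# off-xy)) ⟩
      s + s + # off-xy                                      ≡⟨ cong (s + s +_) (sum-cong-≗ λ z → cong ⟦_⟧ (∧-assoc (col w z) _ _)) ⟩
      s + s + # (λ z → col w z ∧ outside z)                 ∎
      where
      open ≡-Reasoning
      off-x off-xy : Point S → Bool
      off-x z = col w z ∧ not (perp x z)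
      off-xy z = off-x z ∧ not (perp y z)
      only-y : ∀ z → (off-x z ∧ perp y z) ≡ (col w z ∧ perp y z)
      only-y z with col w z in wz | perp x z in xz
      ... | false | _     = refl
      ... | true  | false = refl
      ... | true  | true  = sym (cong (true ∧_) (trace-nbr-not-perp-both w∈tr wz xz))
      #on-y : # (λ z → off-x z ∧ perp y z) ≡ s
      #on-y = trans (sum-cong-≗ λ z → cong ⟦_⟧ (only-y z)) (#-line-perp wy)

    module _ (X₀ : ℕ) (X₀-def : suc t * s ≡ s + s + X₀) where

      #outside-nbrs-of-trace : ∀ {w} → trace w ≡ true → # (λ z → col w z ∧ outside z) ≡ X₀
      #outside-nbrs-of-trace {w} w∈tr =
        +-cancelˡ-≡ (s + s) (# (λ z → col w z ∧ outside z)) X₀ (trans (sym (outside-nbrs-of-trace {w} w∈tr)) X₀-def)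

      sum-traceDegree : sum (λ z → ⟦ outside z ⟧ * traceDegree z) ≡ suc t * X₀
      sum-traceDegree = begin
        sum (λ z → ⟦ outside z ⟧ * traceDegree z)                  ≡⟨ sum-cong-≗ (λ z → cong (⟦ outside z ⟧ *_) (traceDegree≡# z)) ⟩
        sum (λ z → ⟦ outside z ⟧ * # (λ w → col z w ∧ trace w))    ≡⟨ double-count outside trace col ⟩
        sum (λ w → ⟦ trace w ⟧ * # (λ z → col z w ∧ outside z))
          ≡⟨ sum-const-on trace (λ w → # (λ z → col z w ∧ outside z)) X₀ nbrs ⟩
        # trace * X₀                                               ≡⟨ cong (_* X₀) (#-trace x≢y x≁y) ⟩
        suc t * X₀                                                 ∎
        where
        open ≡-Reasoning
        nbrs : ∀ w → trace w ≡ true → # (λ z → col z w ∧ outside z) ≡ X₀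
        nbrs w w∈tr = trans (sum-cong-≗ λ z → cong (λ b → ⟦ b ∧ outside z ⟧) (col-sym z w)) (#outside-nbrs-of-trace {w} w∈tr)

      common-outside : Point S → Point S → ℕ
      common-outside w₁ w₂ = sum (λ z → ⟦ outside z ⟧ * (⟦ col z w₁ ⟧ * ⟦ col z w₂ ⟧))

      common-outside-diag : ∀ {w} → trace w ≡ true → common-outside w w ≡ X₀
      common-outside-diag {w} w∈tr = trans (sum-cong-≗ idem) (#outside-nbrs-of-trace {w} w∈tr)
        where
        idem : ∀ z → ⟦ outside z ⟧ * (⟦ col z w ⟧ * ⟦ col z w ⟧) ≡ ⟦ col w z ∧ outside z ⟧
        idem z rewrite col-sym z w with col w z | outside z
        ... | true  | true  = refl
        ... | true  | false = refl
        ... | false | true  = refl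
        ... | false | false = refl

      -- Apart from x and y, every common neighbour of two trace points lies outside x^⊥ ∪ y^⊥.
      common-outside-off : ∀ {w₁ w₂} → trace w₁ ≡ true → trace w₂ ≡ true → w₁ ≢ w₂ →
                           suc t ≡ 2 + common-outside w₁ w₂
      common-outside-off {w₁} {w₂} w₁∈tr w₂∈tr w₁≢w₂ with ∧-elim {col w₁ x} w₁∈tr | ∧-elim {col w₂ x} w₂∈tr
      ... | w₁x , w₁y | w₂x , w₂y = begin
        suc t                                  ≡⟨ sym (#-trace w₁≢w₂ (trace-coclique w₁∈tr w₂∈tr)) ⟩
        # both                                 ≡⟨ sum-remove (λ z → ⟦ both z ⟧) x ⟩
        ⟦ both x ⟧ + sum but-x                 ≡⟨ cong₂ _+_ (cong ⟦_⟧ both-x) (sum-remove but-x y) ⟩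
        1 + (but-x y + sum but-xy)             ≡⟨ cong (λ k → 1 + (k + sum but-xy)) but-x-y ⟩
        2 + sum but-xy                         ≡⟨ cong (2 +_) (sum-cong-≗ only-outside) ⟩
        2 + common-outside w₁ w₂               ∎
        where
        open ≡-Reasoning
        both : Point S → Bool
        both z = col z w₁ ∧ col z w₂
        but-x but-xy : Point S → ℕ
        but-x z = ⟦ z ≢ᵇ x ⟧ * ⟦ both z ⟧
        but-xy z = ⟦ z ≢ᵇ y ⟧ * but-x z
        both-x : both x ≡ true
        both-x = ∧-intro (col-flip w₁x) (col-flip w₂x)
        but-x-y : but-x y ≡ 1
        but-x-y = cong₂ (λ a b → ⟦ a ⟧ * ⟦ b ⟧) (≢ᵇ-intro (x≢y ∘ sym)) (∧-intro (col-flip w₁y) (col-flip w₂y))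
        not-perp : ∀ {z a} → col w₁ a ≡ true → col w₂ a ≡ true → both z ≡ true → z ≢ a → not (perp a z) ≡ true
        not-perp {z} w₁a w₂a z∈both z≢a = let zw₁ , zw₂ = ∧-elim {col z w₁} z∈both in
          cong not (¬perp z≢a (perp-pair-coclique w₁≢w₂ (trace-coclique w₁∈tr w₂∈tr) zw₁ zw₂ w₁a w₂a z≢a))
        ⟦∧∧⟧ : ∀ a b c → ⟦ a ∧ (b ∧ c) ⟧ ≡ ⟦ a ⟧ * (⟦ b ⟧ * ⟦ c ⟧)
        ⟦∧∧⟧ a b c = trans (⟦∧⟧ a (b ∧ c)) (cong (⟦ a ⟧ *_) (⟦∧⟧ b c))
        only-outside : ∀ z → but-xy z ≡ ⟦ outside z ⟧ * (⟦ col z w₁ ⟧ * ⟦ col z w₂ ⟧)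
        only-outside z = begin
          but-xy z                                  ≡⟨ sym (⟦∧∧⟧ (z ≢ᵇ y) (z ≢ᵇ x) (both z)) ⟩
          ⟦ z ≢ᵇ y ∧ (z ≢ᵇ x ∧ both z) ⟧            ≡⟨ cong ⟦_⟧ (⇔⇒≡ to from) ⟩
          ⟦ outside z ∧ both z ⟧                    ≡⟨ ⟦∧∧⟧ (outside z) (col z w₁) (col z w₂) ⟩
          ⟦ outside z ⟧ * (⟦ col z w₁ ⟧ * ⟦ col z w₂ ⟧) ∎
          where
          to : (z ≢ᵇ y ∧ (z ≢ᵇ x ∧ both z)) ≡ true → (outside z ∧ both z) ≡ true
          to h with ∧-elim {z ≢ᵇ y} h
          ... | z≢y , rest with ∧-elim {z ≢ᵇ x} rest
          ...   | z≢x , z∈both = ∧-intro (∧-intro (not-perp w₁x w₂x z∈both (≢ᵇ-true z≢x))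
                                                  (not-perp w₁y w₂y z∈both (≢ᵇ-true z≢y))) z∈both
          from : (outside z ∧ both z) ≡ true → (z ≢ᵇ y ∧ (z ≢ᵇ x ∧ both z)) ≡ true
          from h with ∧-elim {outside z} h
          ... | out , z∈both with ∧-elim {not (perp x z)} out
          ...   | ¬xz , ¬yz = ∧-intro {z ≢ᵇ y} (≢ᵇ-intro (¬perp⇒≢ {y} (not-injective ¬yz)))
                                      (∧-intro {z ≢ᵇ x} (≢ᵇ-intro (¬perp⇒≢ {x} (not-injective ¬xz))) z∈both)

      module _ (c₀ : ℕ) (c₀-def : t ≡ suc c₀) where

        trace-row-sum : ∀ {w₁} → trace w₁ ≡ true →
                        sum (λ w₂ → ⟦ trace w₂ ⟧ * common-outside w₁ w₂) ≡ X₀ + t * c₀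
        trace-row-sum {w₁} w₁∈tr = begin
          sum row                                          ≡⟨ sum-remove row w₁ ⟩
          row w₁ + sum (λ w₂ → ⟦ w₂ ≢ᵇ w₁ ⟧ * row w₂)     ≡⟨ cong₂ _+_ row-w₁ (sum-cong-≗ regroup) ⟩
          X₀ + sum (λ w₂ → ⟦ others w₂ ⟧ * common-outside w₁ w₂)
                                                           ≡⟨ cong (X₀ +_) (sum-const-on others (common-outside w₁) c₀ off-diag) ⟩
          X₀ + # others * c₀                               ≡⟨ cong (λ k → X₀ + k * c₀) #others ⟩
          X₀ + t * c₀                                      ∎
          where
          open ≡-Reasoning
          row : Point S → ℕ
          row w₂ = ⟦ trace w₂ ⟧ * common-outside w₁ w₂
          others : Point S → Bool
          others w₂ = w₂ ≢ᵇ w₁ ∧ trace w₂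
          row-w₁ : row w₁ ≡ X₀
          row-w₁ rewrite w₁∈tr = trans (+-identityʳ _) (common-outside-diag {w₁} w₁∈tr)
          regroup : ∀ w₂ → ⟦ w₂ ≢ᵇ w₁ ⟧ * row w₂ ≡ ⟦ others w₂ ⟧ * common-outside w₁ w₂
          regroup w₂ = trans (sym (*-assoc ⟦ w₂ ≢ᵇ w₁ ⟧ _ _)) (cong (_* common-outside w₁ w₂) (sym (⟦∧⟧ (w₂ ≢ᵇ w₁) (trace w₂))))
          off-diag : ∀ w₂ → others w₂ ≡ true → common-outside w₁ w₂ ≡ c₀
          off-diag w₂ h = let w₂≢w₁ , w₂∈tr = ∧-elim {w₂ ≢ᵇ w₁} h in
            sym (suc-injective (suc-injective
              (trans (cong suc (sym c₀-def)) (common-outside-off {w₁} {w₂} w₁∈tr w₂∈tr (≢ᵇ-true w₂≢w₁ ∘ sym)))))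
          #others : # others ≡ t
          #others = suc-injective (begin
            suc (# others)                                       ≡⟨ cong (λ b → ⟦ b ⟧ + # others) (sym w₁∈tr) ⟩
            ⟦ trace w₁ ⟧ + # others
              ≡⟨ cong (⟦ trace w₁ ⟧ +_) (sum-cong-≗ λ w₂ → ⟦∧⟧ (w₂ ≢ᵇ w₁) (trace w₂)) ⟩
            ⟦ trace w₁ ⟧ + sum (λ w₂ → ⟦ w₂ ≢ᵇ w₁ ⟧ * ⟦ trace w₂ ⟧) ≡⟨ sym (sum-remove (λ w → ⟦ trace w ⟧) w₁) ⟩
            # trace                                              ≡⟨ #-trace x≢y x≁y ⟩
            suc t                                                ∎)

        sum-traceDegree² : sum (λ z → ⟦ outside z ⟧ * (traceDegree z * traceDegree z)) ≡ suc t * (X₀ + t * c₀)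
        sum-traceDegree² = begin
          sum (λ z → ⟦ outside z ⟧ * (traceDegree z * traceDegree z))
            ≡⟨ sum-*-square (λ z → ⟦ outside z ⟧) (λ z w → ⟦ col z w ⟧ * ⟦ trace w ⟧) ⟩
          sum (λ w₁ → sum (λ w₂ → sum (λ z → ⟦ outside z ⟧ * ((⟦ col z w₁ ⟧ * ⟦ trace w₁ ⟧) * (⟦ col z w₂ ⟧ * ⟦ trace w₂ ⟧)))))
            ≡⟨ sum-cong-≗ (λ w₁ → trans (sum-cong-≗ (factor w₁)) (sum-*ˡ ⟦ trace w₁ ⟧ (λ w₂ → ⟦ trace w₂ ⟧ * common-outside w₁ w₂))) ⟩
          sum (λ w₁ → ⟦ trace w₁ ⟧ * sum (λ w₂ → ⟦ trace w₂ ⟧ * common-outside w₁ w₂))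
            ≡⟨ sum-const-on trace (λ w₁ → sum (λ w₂ → ⟦ trace w₂ ⟧ * common-outside w₁ w₂)) (X₀ + t * c₀) (λ w₁ → trace-row-sum {w₁}) ⟩
          # trace * (X₀ + t * c₀)
            ≡⟨ cong (_* (X₀ + t * c₀)) (#-trace x≢y x≁y) ⟩
          suc t * (X₀ + t * c₀) ∎
          where
          open ≡-Reasoning
          shuffle : ∀ o c₁ p₁ c₂ p₂ → o * ((c₁ * p₁) * (c₂ * p₂)) ≡ p₁ * (p₂ * (o * (c₁ * c₂)))
          shuffle = solve-∀
          factor : ∀ w₁ w₂ → sum (λ z → ⟦ outside z ⟧ * ((⟦ col z w₁ ⟧ * ⟦ trace w₁ ⟧) * (⟦ col z w₂ ⟧ * ⟦ trace w₂ ⟧)))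
                             ≡ ⟦ trace w₁ ⟧ * (⟦ trace w₂ ⟧ * common-outside w₁ w₂)
          factor w₁ w₂ = begin
            _ ≡⟨ sum-cong-≗ (λ z → shuffle ⟦ outside z ⟧ ⟦ col z w₁ ⟧ ⟦ trace w₁ ⟧ ⟦ col z w₂ ⟧ ⟦ trace w₂ ⟧) ⟩
            sum (λ z → ⟦ trace w₁ ⟧ * (⟦ trace w₂ ⟧ * (⟦ outside z ⟧ * (⟦ col z w₁ ⟧ * ⟦ col z w₂ ⟧))))
              ≡⟨ sum-*ˡ ⟦ trace w₁ ⟧ (λ z → ⟦ trace w₂ ⟧ * (⟦ outside z ⟧ * (⟦ col z w₁ ⟧ * ⟦ col z w₂ ⟧))) ⟩
            ⟦ trace w₁ ⟧ * sum (λ z → ⟦ trace w₂ ⟧ * (⟦ outside z ⟧ * (⟦ col z w₁ ⟧ * ⟦ col z w₂ ⟧)))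
              ≡⟨ cong (⟦ trace w₁ ⟧ *_) (sum-*ˡ ⟦ trace w₂ ⟧ (λ z → ⟦ outside z ⟧ * (⟦ col z w₁ ⟧ * ⟦ col z w₂ ⟧))) ⟩
            ⟦ trace w₁ ⟧ * (⟦ trace w₂ ⟧ * common-outside w₁ w₂) ∎

    #outside : ∀ Y₀ B₀ → suc t * s ≡ s + Y₀ → suc t * s ≡ suc t + B₀ → s * Y₀ ≡ 1 + B₀ + # outside
    #outside Y₀ B₀ Y₀-def B₀-def = begin
      s * Y₀                                                 ≡⟨ sym (#-not-perp x Y₀ Y₀-def) ⟩
      # far-x                                                ≡⟨ #-split far-x (perp y) ⟩
      # (λ z → far-x z ∧ perp y z) + # outside               ≡⟨ cong (_+ # outside) (sum-remove (λ z → ⟦ far-x z ∧ perp y z ⟧) y) ⟩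
      ⟦ far-x y ∧ perp y y ⟧ + sum near-y + # outside         ≡⟨ cong (λ k → k + sum near-y + # outside) y-far-x ⟩
      1 + sum near-y + # outside
        ≡⟨ cong (λ k → 1 + k + # outside) (trans (sum-cong-≗ (λ z → trans (sym (⟦∧⟧ (z ≢ᵇ y) _)) (cong ⟦_⟧ (near-y≡ z)))) #y-nbrs-far-x) ⟩
      1 + B₀ + # outside                                     ∎
      where
      open ≡-Reasoning
      far-x : Point S → Bool
      far-x z = not (perp x z)
      near-y : Point S → ℕ
      near-y z = ⟦ z ≢ᵇ y ⟧ * ⟦ far-x z ∧ perp y z ⟧
      y-far-x : ⟦ far-x y ∧ perp y y ⟧ ≡ 1
      y-far-x = cong ⟦_⟧ (∧-intro {far-x y} (cong not (¬perp (x≢y ∘ sym) (col-flip x≁y))) (perp-refl y))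
      near-y≡ : ∀ z → (z ≢ᵇ y ∧ (far-x z ∧ perp y z)) ≡ (col y z ∧ far-x z)
      near-y≡ z = ⇔⇒≡ to from
        where
        to : (z ≢ᵇ y ∧ (far-x z ∧ perp y z)) ≡ true → (col y z ∧ far-x z) ≡ true
        to h with ∧-elim {z ≢ᵇ y} h
        ... | z≢y , rest with ∧-elim {far-x z} rest
        ...   | fx , yz with perp-elim {y} {z} yz
        ...     | inj₁ z≡y = ⊥-elim (≢ᵇ-true z≢y z≡y)
        ...     | inj₂ zy  = ∧-intro {col y z} (col-flip zy) fx
        from : (col y z ∧ far-x z) ≡ true → (z ≢ᵇ y ∧ (far-x z ∧ perp y z)) ≡ true
        from h with ∧-elim {col y z} h
        ... | yz , fx = ∧-intro {z ≢ᵇ y} (≢ᵇ-intro (proj₁ (col⇒line yz) ∘ sym)) (∧-intro {far-x z} fx (col⇒perp (col-flip yz)))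
      trace≡ : ∀ z → (col y z ∧ perp x z) ≡ trace z
      trace≡ z = ⇔⇒≡ to from
        where
        to : (col y z ∧ perp x z) ≡ true → trace z ≡ true
        to h with ∧-elim {col y z} h
        ... | yz , xz with perp-elim {x} {z} xz
        ...   | inj₁ refl = ⊥-elim (false≢true (col-flip x≁y) yz)
        ...   | inj₂ zx   = ∧-intro {col z x} zx (col-flip yz)
        from : trace z ≡ true → (col y z ∧ perp x z) ≡ true
        from h with ∧-elim {col z x} h
        ... | zx , zy = ∧-intro {col y z} (col-flip zy) (col⇒perp zx)
      #y-nbrs-far-x : # (λ z → col y z ∧ far-x z) ≡ B₀
      #y-nbrs-far-x = +-cancelˡ-≡ (suc t) (# (λ z → col y z ∧ far-x z)) B₀ (begin
        suc t + # (λ z → col y z ∧ far-x z)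
          ≡⟨ cong (_+ # (λ z → col y z ∧ far-x z)) (sym (trans (sum-cong-≗ (λ z → cong ⟦_⟧ (trace≡ z))) (#-trace x≢y x≁y))) ⟩
        # (λ z → col y z ∧ perp x z) + # (λ z → col y z ∧ far-x z)   ≡⟨ sym (#-split (col y) (perp x)) ⟩
        # (col y)                                                    ≡⟨ degree y ⟩
        suc t * s                                                    ≡⟨ B₀-def ⟩
        suc t + B₀                                                   ∎)

    T : Point S → ℕ
    T = Tmult S s x y

    adjT : Point S → ℕ
    adjT z = sum (λ w → ⟦ col z w ⟧ * T w)

    adjT-expand : ∀ z → adjT z ≡ traceDegree z + s * (⟦ col z x ⟧ + ⟦ col z y ⟧)
    adjT-expand z = begin
      adjT z                                                     ≡⟨ sum-cong-≗ distribute ⟩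
      sum (λ w → c w * ⟦ trace w ⟧ + s * (c w * δx w + c w * δy w))
        ≡⟨ ∑-distrib-+ (λ w → c w * ⟦ trace w ⟧) (λ w → s * (c w * δx w + c w * δy w)) ⟩
      traceDegree z + sum (λ w → s * (c w * δx w + c w * δy w))
        ≡⟨ cong (traceDegree z +_) (sum-*ˡ s (λ w → c w * δx w + c w * δy w)) ⟩
      traceDegree z + s * sum (λ w → c w * δx w + c w * δy w)
        ≡⟨ cong (λ k → traceDegree z + s * k) (∑-distrib-+ (λ w → c w * δx w) (λ w → c w * δy w)) ⟩
      traceDegree z + s * (sum (λ w → c w * δx w) + sum (λ w → c w * δy w))
        ≡⟨ cong (λ k → traceDegree z + s * k) (cong₂ _+_ (pick x) (pick y)) ⟩
      traceDegree z + s * (⟦ col z x ⟧ + ⟦ col z y ⟧)             ∎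
      where
      open ≡-Reasoning
      c δx δy : Point S → ℕ
      c w = ⟦ col z w ⟧
      δx w = ⟦ ⌊ w ≟ x ⌋ ⟧
      δy w = ⟦ ⌊ w ≟ y ⌋ ⟧
      spread : ∀ c τ s a b → c * (τ + s * (a + b)) ≡ c * τ + s * (c * a + c * b)
      spread = solve-∀
      distribute : ∀ w → c w * T w ≡ c w * ⟦ trace w ⟧ + s * (c w * δx w + c w * δy w)
      distribute w = spread (c w) ⟦ trace w ⟧ s (δx w) (δy w)
      pick : ∀ a → sum (λ w → c w * ⟦ ⌊ w ≟ a ⌋ ⟧) ≡ c a
      pick a = trans (sum-concentrated (λ w → c w * ⟦ ⌊ w ≟ a ⌋ ⟧) a
                       (λ w w≢a → trans (cong (λ b → c w * ⟦ b ⟧) (⌊≟⌋-≢ w≢a)) (*-zeroʳ (c w))))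
                     (trans (cong (λ b → c a * ⟦ b ⟧) (⌊≟⌋-refl a)) (*-identityʳ (c a)))

    traceDegree-full : ∀ {a} → (∀ {w} → trace w ≡ true → col w a ≡ true) → traceDegree a ≡ suc t
    traceDegree-full {a} on-a = trans (sum-cong-≗ pointwise) (#-trace x≢y x≁y)
      where
      pointwise : ∀ w → ⟦ col a w ⟧ * ⟦ trace w ⟧ ≡ ⟦ trace w ⟧
      pointwise w with trace w in w∈tr
      ... | true  = cong (λ b → ⟦ b ⟧ * 1) (col-flip (on-a {w} w∈tr))
      ... | false = *-zeroʳ ⟦ col a w ⟧

    traceDegree-trace : ∀ {z} → trace z ≡ true → traceDegree z ≡ 0
    traceDegree-trace {z} z∈tr = trans (traceDegree≡# z)
      (#-empty _ λ w h → let zw , w∈tr = ∧-elim {col z w} h in false≢true (trace-coclique z∈tr w∈tr) zw)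

    traceDegree-x-only : ∀ {z} → col z x ≡ true → col z y ≡ false → traceDegree z ≡ 1
    traceDegree-x-only {z} zx z≁y = trans (traceDegree≡# z) (unique-centre x≢y x≁y zx z≁y)

    traceDegree-y-only : ∀ {z} → col z x ≡ false → col z y ≡ true → traceDegree z ≡ 1
    traceDegree-y-only {z} z≁x zy = trans (traceDegree≡# z)
      (trans (sum-cong-≗ λ w → cong (λ b → ⟦ col z w ∧ b ⟧) (∧-comm (col w x) (col w y)))
             (unique-centre (x≢y ∘ sym) (col-flip x≁y) zy z≁x))

    T-off : ∀ {z} → z ≢ x → z ≢ y → T z ≡ ⟦ trace z ⟧
    T-off {z} z≢x z≢y = begin
      ⟦ trace z ⟧ + s * (⟦ ⌊ z ≟ x ⌋ ⟧ + ⟦ ⌊ z ≟ y ⌋ ⟧)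
        ≡⟨ cong₂ (λ a b → ⟦ trace z ⟧ + s * (⟦ a ⟧ + ⟦ b ⟧)) (⌊≟⌋-≢ z≢x) (⌊≟⌋-≢ z≢y) ⟩
      ⟦ trace z ⟧ + s * 0                            ≡⟨ cong (⟦ trace z ⟧ +_) (*-zeroʳ s) ⟩
      ⟦ trace z ⟧ + 0                                ≡⟨ +-identityʳ ⟦ trace z ⟧ ⟩
      ⟦ trace z ⟧                                    ∎
      where open ≡-Reasoning

    T-x : T x ≡ s
    T-x rewrite col-irrefl x | ⌊≟⌋-refl x | ⌊≟⌋-≢ x≢y = *-identityʳ s

    T-y : T y ≡ s
    T-y rewrite col-flip x≁y | ⌊≟⌋-refl y | ⌊≟⌋-≢ (x≢y ∘ sym) = trans (cong (s *_) (+-identityʳ 1)) (*-identityʳ s)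

    adjT-x : adjT x ≡ suc t
    adjT-x rewrite adjT-expand x | traceDegree-full {x} (λ {w} → proj₁ ∘ ∧-elim {col w x}) | col-irrefl x | x≁y =
      trans (cong (suc t +_) (*-zeroʳ s)) (+-identityʳ (suc t))

    adjT-y : adjT y ≡ suc t
    adjT-y rewrite adjT-expand y | traceDegree-full {y} (λ {w} → proj₂ ∘ ∧-elim {col w x}) | col-flip x≁y | col-irrefl y =
      trans (cong (suc t +_) (*-zeroʳ s)) (+-identityʳ (suc t))

    off-balance : ∀ {z} → z ≢ x → z ≢ y → (∀ {z} → outside z ≡ true → traceDegree z ≡ suc s) →
      traceDegree z + s * (⟦ col z x ⟧ + ⟦ col z y ⟧) + ⟦ col z x ∧ col z y ⟧ ≡ s * ⟦ col z x ∧ col z y ⟧ + suc s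
    off-balance {z} z≢x z≢y centres = by-collinearity (col z x) refl (col z y) refl
      where
      both : ∀ s → 0 + s * (1 + 1) + 1 ≡ s * 1 + suc s
      both = solve-∀
      one : ∀ s → 1 + s * (1 + 0) + 0 ≡ s * 0 + suc s
      one = solve-∀
      other : ∀ s → 1 + s * (0 + 1) + 0 ≡ s * 0 + suc s
      other = solve-∀
      neither : ∀ s → suc s + s * (0 + 0) + 0 ≡ s * 0 + suc s
      neither = solve-∀
      by-collinearity : ∀ a → col z x ≡ a → ∀ b → col z y ≡ b →
        traceDegree z + s * (⟦ col z x ⟧ + ⟦ col z y ⟧) + ⟦ col z x ∧ col z y ⟧ ≡ s * ⟦ col z x ∧ col z y ⟧ + suc s
      by-collinearity true  zx true  zy rewrite zx | zy | traceDegree-trace {z} (∧-intro {col z x} zx zy) = both s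
      by-collinearity true  zx false zy rewrite zx | zy | traceDegree-x-only zx zy = one s
      by-collinearity false zx true  zy rewrite zx | zy | traceDegree-y-only zx zy = other s
      by-collinearity false zx false zy rewrite zx | zy
        | centres {z} (cong₂ _∧_ (cong not (¬perp z≢x zx)) (cong not (¬perp z≢y zy))) = neither s

    Tmult-equation : t ≡ s * s → (∀ {z} → outside z ≡ true → traceDegree z ≡ suc s) →
                     ∀ z → adjT z + T z ≡ s * T z + suc s
    Tmult-equation t≡s² centres z = by-cases z (z ≟ x) (z ≟ y)
      where
      end-point : ∀ {a} → adjT a ≡ suc t → T a ≡ s → adjT a + T a ≡ s * T a + suc s
      end-point adj Ta rewrite adj | Ta | t≡s² = end-point-identity s
        where
        end-point-identity : ∀ s → suc (s * s) + s ≡ s * s + suc s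
        end-point-identity = solve-∀
      by-cases : ∀ z → Dec (z ≡ x) → Dec (z ≡ y) → adjT z + T z ≡ s * T z + suc s
      by-cases .x (yes refl) _          = end-point {x} adjT-x T-x
      by-cases .y (no _)     (yes refl) = end-point {y} adjT-y T-y
      by-cases z  (no z≢x)   (no z≢y)   = begin
        adjT z + T z                                                       ≡⟨ cong₂ _+_ (adjT-expand z) (T-off z≢x z≢y) ⟩
        traceDegree z + s * (⟦ col z x ⟧ + ⟦ col z y ⟧) + ⟦ trace z ⟧     ≡⟨ off-balance z≢x z≢y (λ {z} → centres {z}) ⟩
        s * ⟦ trace z ⟧ + suc s                                             ≡⟨ cong (λ k → s * k + suc s) (sym (T-off z≢x z≢y)) ⟩
        s * T z + suc s                                                     ∎
        where open ≡-Reasoning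

-- Quadrangles of order (s, s²)

module OrderSSquared (S : IncStr) (r : ℕ) (G : IsGQ S (suc r) (suc r * suc r)) where
  open Quadrangle S G

  module _ {x y : Point S} (x≢y : x ≢ y) (x≁y : col x y ≡ false) where
    open Trace x≢y x≁y

    -- The first two moments of traceDegree over the outside points force it to be constant.
    traceDegree-outside : ∀ {z} → outside z ≡ true → traceDegree z ≡ suc (suc r)
    traceDegree-outside {z} = zero-variance⇒constant outside traceDegree m variance z
      where
      s t u m X₀ Y₀ B₀ : ℕ
      s = suc r
      t = s * s
      u = r * (2 + r)
      m = suc s
      X₀ = u * s
      Y₀ = t * s
      B₀ = suc t * r
      X₀-def : ∀ r → let s = suc r; t = s * s in suc t * s ≡ s + s + r * (2 + r) * s
      X₀-def = solve-∀
      t-def : ∀ r → suc r * suc r ≡ suc (r * (2 + r))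
      t-def = solve-∀
      Y₀-def : ∀ r → let s = suc r; t = s * s in suc t * s ≡ s + t * s
      Y₀-def = solve-∀
      B₀-def : ∀ r → let s = suc r; t = s * s in suc t * s ≡ suc t + suc t * r
      B₀-def = solve-∀
      moments : ∀ r → let s = suc r; t = s * s; u = r * (2 + r); m = suc s in
        s * (t * s) * (m * m) + suc t * (u * s + t * u) ≡ (1 + suc t * r) * (m * m) + 2 * m * (suc t * (u * s))
      moments = solve-∀
      n : ℕ
      n = # outside
      S₁ S₂ : ℕ
      S₁ = sum (λ z → ⟦ outside z ⟧ * traceDegree z)
      S₂ = sum (λ z → ⟦ outside z ⟧ * (traceDegree z * traceDegree z))
      variance : S₂ + n * (m * m) ≡ 2 * m * S₁
      variance = +-cancelˡ-≡ ((1 + B₀) * (m * m)) (S₂ + n * (m * m)) (2 * m * S₁) (begin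
        (1 + B₀) * (m * m) + (S₂ + n * (m * m))     ≡⟨ regroup (1 + B₀) S₂ n (m * m) ⟩
        (1 + B₀ + n) * (m * m) + S₂                 ≡⟨ cong₂ (λ k l → k * (m * m) + l) (sym (#outside Y₀ B₀ (Y₀-def r) (B₀-def r)))
                                                               (sum-traceDegree² X₀ (X₀-def r) u (t-def r)) ⟩
        s * Y₀ * (m * m) + suc t * (X₀ + t * u)     ≡⟨ moments r ⟩
        (1 + B₀) * (m * m) + 2 * m * (suc t * X₀)
          ≡⟨ cong (λ k → (1 + B₀) * (m * m) + 2 * m * k) (sym (sum-traceDegree X₀ (X₀-def r))) ⟩
        (1 + B₀) * (m * m) + 2 * m * S₁             ∎)
        where
        open ≡-Reasoning
        regroup : ∀ a b c d → a * d + (b + c * d) ≡ (a + c) * d + b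
        regroup = solve-∀

    Tmult-affine : ∀ z → adjT z + T z ≡ suc r * T z + suc (suc r)
    Tmult-affine = Tmult-equation refl (λ {z} → traceDegree-outside {z})

open Eigenvectors using (affine⇒WeightedTight)

trace-weightedTight : ∀ S r → IsGQ S (suc r) (suc r * suc r) → ∀ {x y} → x ≢ y → collinear S x y ≡ false →
                      WeightedTight S (suc r) (Tmult S (suc r) x y)
trace-weightedTight S r G x≢y x≁y = affine⇒WeightedTight S (suc r) regular _ (Tmult-affine x≢y x≁y)
  where
  open Quadrangle S G using (degree)
  open OrderSSquared S r G using (Tmult-affine)
  regular : ∀ x → # collinear S x ≡ suc r * (suc r * suc r + 1)
  regular x = trans (degree x) (reorder r)
    where
    reorder : ∀ r → suc (suc r * suc r) * suc r ≡ suc r * (suc r * suc r + 1)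
    reorder = solve-∀

lemma5p1 : (S : IncStr) (s k : ℕ) → s ≡ 2 * k + 1 → 1 ≤ k →
    IsGQ S s (s * s) →
    (x y : Point S) → x ≢ y → collinear S x y ≡ false →
    WeightedTight S s (Tmult S s x y)
lemma5p1 S s k s≡2k+1 _ = subst
  (λ s → IsGQ S s (s * s) → (x y : Point S) → x ≢ y → collinear S x y ≡ false → WeightedTight S s (Tmult S s x y))
  (sym (trans s≡2k+1 (+-comm (2 * k) 1)))
  (λ G x y → trace-weightedTight S (2 * k) G)
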